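{- Let $w$ be a $\mathfrak p$-norm on $L$, let $(b'_1,\dots,b'_n)$ be a $K$-basis of $L$ which is $w$-semi-orthonormal, let $T\in\mathrm{GL}_n(A_{\mathfrak p})$, and define $(b_1,\dots,b_n)$ by $(b'_1,\dots,b'_n)T=(b_1,\dots,b_n)$. Then $(b_1,\dots,b_n)$ is a $w$-semi-orthonormal basis.
   Context: $A$ is a Dedekind domain with fraction field $K$, $\mathfrak p$ a nonzero prime of $A$ with valuation $v_{\mathfrak p}$, $A_{\mathfrak p}$ the localization; $L/K$ a finite separable extension of degree $n$. A $\mathfrak p$-norm on $L$ is a map $w:L\to\mathbb Q\cup\{\infty\}$ with (1) $w(x+y)\ge\min\{w(x),w(y)\}$, equality if $w(x)\ne w(y)$; (2) $w(ax)=v_{\mathfrak p}(a)+w(x)$ for $a\in K$, $x\in L$; (3) $w(x)=\infty$ iff $x=0$. A set $\mathcal B\subset L$ is $w$-semi-orthonormal if $\lfloor w(\sum_b\lambda_bb)\rfloor=\min_b\lfloor w(\lambda_bb)\rfloor$ for all families $(\lambda_b)_{b\in\mathcal B}$ of elements of $K$, and $0\le w(b)<1$ for all $b\in\mathcal B$. -}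

module Defs where

open import Level using (0ℓ)
open import Data.Nat using (ℕ; zero; suc)
open import Data.Fin using (Fin; zero; suc)
open import Data.Fin.Properties using () renaming (_≟_ to _≟ᶠ_)
open import Data.Integer as ℤ using (ℤ)
open import Data.Rational as ℚ using (ℚ; floor)
open import Data.Product using (_×_; ∃; Σ)
open import Relation.Binary.PropositionalEquality using (_≡_; _≢_)
open import Relation.Nullary using (¬_; yes; no)
open import Function.Bundles using (_⇔_)
open import Algebra.Bundles using (CommutativeRing)
open import Algebra.Morphism.Structures using (module RingMorphisms)

data WithTop (A : Set) : Set where
  [_] : A → WithTop A
  ∞   : WithTop A

ℤ∞ : Set
ℤ∞ = WithTop ℤ

ℚ∞ : Set
ℚ∞ = WithTop ℚ

data _≤ℤ∞_ : ℤ∞ → ℤ∞ → Set where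
  fin≤ : ∀ {a b} → a ℤ.≤ b → [ a ] ≤ℤ∞ [ b ]
  ≤∞   : ∀ {x} → x ≤ℤ∞ ∞

data _≤ℚ∞_ : ℚ∞ → ℚ∞ → Set where
  fin≤ : ∀ {a b} → a ℚ.≤ b → [ a ] ≤ℚ∞ [ b ]
  ≤∞   : ∀ {x} → x ≤ℚ∞ ∞

data _<ℚ∞_ : ℚ∞ → ℚ∞ → Set where
  fin< : ∀ {a b} → a ℚ.< b → [ a ] <ℚ∞ [ b ]
  <∞   : ∀ {a} → [ a ] <ℚ∞ ∞

minℤ∞ : ℤ∞ → ℤ∞ → ℤ∞
minℤ∞ [ a ] [ b ] = [ a ℤ.⊓ b ]
minℤ∞ [ a ] ∞ = [ a ]
minℤ∞ ∞ y = y

minℚ∞ : ℚ∞ → ℚ∞ → ℚ∞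
minℚ∞ [ a ] [ b ] = [ a ℚ.⊓ b ]
minℚ∞ [ a ] ∞ = [ a ]
minℚ∞ ∞ y = y

_+ℤ∞_ : ℤ∞ → ℤ∞ → ℤ∞
[ a ] +ℤ∞ [ b ] = [ a ℤ.+ b ]
[ a ] +ℤ∞ ∞ = ∞
∞ +ℤ∞ y = ∞

_⊕_ : ℤ∞ → ℚ∞ → ℚ∞
[ a ] ⊕ [ q ] = [ (a ℚ./ 1) ℚ.+ q ]
[ a ] ⊕ ∞ = ∞
∞ ⊕ y = ∞

⌊_⌋∞ : ℚ∞ → ℤ∞
⌊ [ q ] ⌋∞ = [ floor q ]
⌊ ∞ ⌋∞ = ∞

minFin : ∀ {n} → (Fin n → ℤ∞) → ℤ∞
minFin {zero} f = ∞
minFin {suc n} f = minℤ∞ (f zero) (minFin (λ i → f (suc i)))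

record IsField (R : CommutativeRing 0ℓ 0ℓ) : Set where
  open CommutativeRing R using (Carrier; 0#; 1#; _*_; _≈_)
  field
    1≉0 : ¬ (1# ≈ 0#)
    inverse : ∀ x → ¬ (x ≈ 0#) → ∃ λ y → x * y ≈ 1#

module _ (R : CommutativeRing 0ℓ 0ℓ) where
  open CommutativeRing R using (Carrier; 0#; _+_)

  Σ[_] : ∀ {n} → (Fin n → Carrier) → Carrier
  Σ[_] {zero} f = 0#
  Σ[_] {suc n} f = f zero + Σ[_] (λ i → f (suc i))

record IsDiscreteValuation (K : CommutativeRing 0ℓ 0ℓ)
         (v : CommutativeRing.Carrier K → ℤ∞) : Set where
  open CommutativeRing K using (Carrier; 0#; _+_; _*_; _≈_)
  field
    v-cong : ∀ {x y} → x ≈ y → v x ≡ v y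
    v-∞    : ∀ x → (v x ≡ ∞) ⇔ (x ≈ 0#)
    v-mul  : ∀ x y → v (x * y) ≡ v x +ℤ∞ v y
    v-add  : ∀ x y → minℤ∞ (v x) (v y) ≤ℤ∞ v (x + y)
    v-normalised : ∃ λ π → v π ≡ [ ℤ.+ 1 ]

InAp : (K : CommutativeRing 0ℓ 0ℓ) (v : CommutativeRing.Carrier K → ℤ∞) →
       CommutativeRing.Carrier K → Set
InAp K v a = [ ℤ.+ 0 ] ≤ℤ∞ v a

module _ (K : CommutativeRing 0ℓ 0ℓ) where
  open CommutativeRing K using (Carrier; 0#; 1#; _*_; _≈_)

  Matrix : ℕ → Set
  Matrix n = Fin n → Fin n → Carrier

  _·_ : ∀ {n} → Matrix n → Matrix n → Matrix n
  (T · S) i k = Σ[ K ] (λ j → T i j * S j k)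

  I : ∀ {n} → Matrix n
  I i j with i ≟ᶠ j
  ... | yes _ = 1#
  ... | no _ = 0#

  _≈M_ : ∀ {n} → Matrix n → Matrix n → Set
  T ≈M S = ∀ i j → T i j ≈ S i j

  InGL : (v : Carrier → ℤ∞) → ∀ {n} → Matrix n → Set
  InGL v {n} T = (∀ i j → InAp K v (T i j)) ×
    ∃ λ (S : Matrix n) → (∀ i j → InAp K v (S i j)) ×
      ((T · S) ≈M I) × ((S · T) ≈M I)

module Extension (K L : CommutativeRing 0ℓ 0ℓ)
                 (ι : CommutativeRing.Carrier K → CommutativeRing.Carrier L) where
  private
    module K = CommutativeRing K
    module L = CommutativeRing L

  _•_ : K.Carrier → L.Carrier → L.Carrier
  a • x = ι a L.* x

  lincomb : ∀ {n} → (Fin n → K.Carrier) → (Fin n → L.Carrier) → L.Carrier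
  lincomb λs b = Σ[ L ] (λ i → λs i • b i)

  IsBasis : ∀ {n} → (Fin n → L.Carrier) → Set
  IsBasis b = (∀ λs → lincomb λs b L.≈ L.0# → ∀ i → λs i K.≈ K.0#)
            × (∀ x → ∃ λ λs → lincomb λs b L.≈ x)

  record IsPNorm (v : K.Carrier → ℤ∞) (w : L.Carrier → ℚ∞) : Set where
    field
      w-cong  : ∀ {x y} → x L.≈ y → w x ≡ w y
      w-ultra : ∀ x y → minℚ∞ (w x) (w y) ≤ℚ∞ w (x L.+ y)
      w-ultra-eq : ∀ x y → w x ≢ w y → w (x L.+ y) ≡ minℚ∞ (w x) (w y)
      w-scalar : ∀ a x → w (a • x) ≡ v a ⊕ w x
      w-∞ : ∀ x → (w x ≡ ∞) ⇔ (x L.≈ L.0#)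

  SemiOrthonormal : (w : L.Carrier → ℚ∞) → ∀ {n} → (Fin n → L.Carrier) → Set
  SemiOrthonormal w b =
      (∀ λs → ⌊ w (lincomb λs b) ⌋∞ ≡ minFin (λ i → ⌊ w (λs i • b i) ⌋∞))
    × (∀ i → ([ ℚ.0ℚ ] ≤ℚ∞ w (b i)) × (w (b i) <ℚ∞ [ ℚ.1ℚ ]))

  -- (b_1,…,b_n) = (b'_1,…,b'_n) T, i.e. b_j = Σ_i T_ij b'_i
  transform : ∀ {n} → (Fin n → L.Carrier) → Matrix K n → (Fin n → L.Carrier)
  transform b' T j = lincomb (λ i → T i j) b'

{-# OPTIONS --safe #-}
-- For a semi-orthonormal family b' (so 0 ≤ w(b'ᵢ) < 1) the floor of the norm of a
-- combination is the least valuation of its coefficients: ⌊w(Σ xᵢ b'ᵢ)⌋ = minᵢ v(xᵢ).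
-- Conversely this identity forces semi-orthonormality (unit vectors give
-- ⌊w(bⱼ)⌋ = v(1) = 0) and linear independence (w(0) = ∞).  Since Σ xⱼ bⱼ = Σ (T x)ᵢ b'ᵢ,
-- the identity passes from b' to b = b'T as soon as minᵢ v((T x)ᵢ) = minᵢ v(xᵢ), which
-- holds because neither T nor T⁻¹, having entries in A_p, can lower the least valuation.
-- Spanning is inherited through T⁻¹.
module Submission where

open import Defs
open import Level using (0ℓ)
open import Algebra.Bundles using (CommutativeRing; CommutativeMonoid; AbelianGroup)
open import Algebra.Morphism.Structures using (module RingMorphisms)
import Algebra.Properties.CommutativeMonoid.Sum as MonoidSum
import Algebra.Properties.CommutativeSemigroup as CommutativeSemigroupProperties
import Algebra.Properties.Group as GroupProperties
import Algebra.Properties.Semiring.Sum as SemiringSum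
open import Data.Empty using (⊥-elim)
open import Data.Fin using (Fin; zero; suc; punchIn)
open import Data.Fin.Properties using (punchInᵢ≢i) renaming (_≟_ to _≟ᶠ_)
open import Data.Integer as ℤ using (+_)
import Data.Integer.DivMod as ℤ
import Data.Integer.Properties as ℤP
open import Data.Nat as ℕ using (ℕ)
import Data.Nat.Coprimality as Coprimality
open import Data.Product using (_×_; _,_; ∃)
open import Data.Rational as ℚ using (mkℚ; floor; ↥_; ↧_)
import Data.Rational.Properties as ℚP
open import Function using (_∘_; case_of_)
open import Function.Bundles using (Equivalence; _⇔_; mk⇔)
open import Relation.Binary.PropositionalEquality
  using (_≡_; _≢_; refl; sym; trans; cong; cong₂; subst; subst₂; module ≡-Reasoning)
open import Relation.Nullary using (¬_; yes; no)

z/1≡mkℚ : ∀ z → z ℚ./ 1 ≡ mkℚ z 0 (Coprimality.sym (Coprimality.1-coprimeTo ℤ.∣ z ∣))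
z/1≡mkℚ z = ℚP.↥p/↧p≡p (mkℚ z 0 _)

↥[z/1] : ∀ z → ↥ (z ℚ./ 1) ≡ z
↥[z/1] z = cong ↥_ (z/1≡mkℚ z)

↧[z/1] : ∀ z → ↧ (z ℚ./ 1) ≡ + 1
↧[z/1] z = cong ↧_ (z/1≡mkℚ z)

/1-homo-+ : ∀ a b → (a ℤ.+ b) ℚ./ 1 ≡ a ℚ./ 1 ℚ.+ b ℚ./ 1
/1-homo-+ a b rewrite z/1≡mkℚ a | z/1≡mkℚ b | ℤP.*-identityʳ a | ℤP.*-identityʳ b = refl

↥[z/1]*↧q : ∀ z q → ↥ (z ℚ./ 1) ℤ.* ↧ q ≡ z ℤ.* ↧ q
↥[z/1]*↧q z q = cong (ℤ._* ↧ q) (↥[z/1] z)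

↥q*↧[z/1] : ∀ z q → ↥ q ℤ.* ↧ (z ℚ./ 1) ≡ ↥ q
↥q*↧[z/1] z q = trans (cong (↥ q ℤ.*_) (↧[z/1] z)) (ℤP.*-identityʳ (↥ q))

z/1≤⇔ : ∀ z q → z ℚ./ 1 ℚ.≤ q ⇔ z ℤ.* ↧ q ℤ.≤ ↥ q
z/1≤⇔ z q = mk⇔ (subst₂ ℤ._≤_ (↥[z/1]*↧q z q) (↥q*↧[z/1] z q) ∘ ℚP.drop-*≤*)
                (ℚ.*≤* ∘ subst₂ ℤ._≤_ (sym (↥[z/1]*↧q z q)) (sym (↥q*↧[z/1] z q)))

<z/1⇔ : ∀ z q → q ℚ.< z ℚ./ 1 ⇔ ↥ q ℤ.< z ℤ.* ↧ q
<z/1⇔ z q = mk⇔ (subst₂ ℤ._<_ (↥q*↧[z/1] z q) (↥[z/1]*↧q z q) ∘ ℚP.drop-*<*)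
                (ℚ.*<* ∘ subst₂ ℤ._<_ (sym (↥q*↧[z/1] z q)) (sym (↥[z/1]*↧q z q)))

i<suc[j]⇒i≤j : ∀ {i j} → i ℤ.< ℤ.suc j → i ℤ.≤ j
i<suc[j]⇒i≤j {i} {j} i<1+j = subst (i ℤ.≤_) (ℤP.pred-suc j) (ℤP.i<j⇒i≤pred[j] i<1+j)

/ℕ-unique : ∀ n d .{{_ : ℕ.NonZero d}} z →
            z ℤ.* + d ℤ.≤ n → n ℤ.< ℤ.suc z ℤ.* + d → n ℤ./ℕ d ≡ z
/ℕ-unique n d z lo hi = ℤP.≤-antisym
  (i<suc[j]⇒i≤j (ℤP.*-cancelʳ-<-nonNeg (+ d) (ℤP.≤-<-trans (ℤ.[n/ℕd]*d≤n n d) hi)))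
  (i<suc[j]⇒i≤j (ℤP.*-cancelʳ-<-nonNeg (+ d) (ℤP.≤-<-trans lo (ℤ.n<s[n/ℕd]*d n d))))

floor-unique : ∀ z q → z ℚ./ 1 ℚ.≤ q → q ℚ.< ℤ.suc z ℚ./ 1 → floor q ≡ z
floor-unique z q@(mkℚ n d _) lo hi = trans (ℤ.div-pos-is-/ℕ n (ℕ.suc d))
  (/ℕ-unique n (ℕ.suc d) z (Equivalence.to (z/1≤⇔ z q) lo) (Equivalence.to (<z/1⇔ (ℤ.suc z) q) hi))

floor-bounds : ∀ q → floor q ℚ./ 1 ℚ.≤ q × q ℚ.< ℤ.suc (floor q) ℚ./ 1
floor-bounds q@(mkℚ n d _) =
    Equivalence.from (z/1≤⇔ (floor q) q) (ℤ.[n/d]*d≤n n (↧ q))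
  , Equivalence.from (<z/1⇔ (ℤ.suc (floor q)) q)
      (subst (λ f → n ℤ.< ℤ.suc f ℤ.* ↧ q) (sym (ℤ.div-pos-is-/ℕ n (ℕ.suc d))) (ℤ.n<s[n/ℕd]*d n (ℕ.suc d)))

floor-+ : ∀ z q → floor (z ℚ./ 1 ℚ.+ q) ≡ z ℤ.+ floor q
floor-+ z q with floor-bounds q
... | lower , upper = floor-unique (z ℤ.+ floor q) (z ℚ./ 1 ℚ.+ q)
  (subst (ℚ._≤ z ℚ./ 1 ℚ.+ q) (sym (/1-homo-+ z (floor q))) (ℚP.+-monoʳ-≤ (z ℚ./ 1) lower))
  (subst (z ℚ./ 1 ℚ.+ q ℚ.<_) (sym (trans (cong (ℚ._/ 1) 1+[z+f]≡z+[1+f]) (/1-homo-+ z (ℤ.suc (floor q)))))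
    (ℚP.+-monoʳ-< (z ℚ./ 1) upper))
  where
  open CommutativeSemigroupProperties ℤP.+-commutativeSemigroup using (x∙yz≈y∙xz)
  1+[z+f]≡z+[1+f] : ℤ.suc (z ℤ.+ floor q) ≡ z ℤ.+ ℤ.suc (floor q)
  1+[z+f]≡z+[1+f] = x∙yz≈y∙xz (+ 1) z (floor q)

[]-injective : ∀ {A : Set} {a b : A} → [ a ] ≡ [ b ] → a ≡ b
[]-injective refl = refl

≤ℤ∞-refl : ∀ {x} → x ≤ℤ∞ x
≤ℤ∞-refl {[ a ]} = fin≤ ℤP.≤-refl
≤ℤ∞-refl {∞} = ≤∞

≤ℤ∞-reflexive : ∀ {x y} → x ≡ y → x ≤ℤ∞ y
≤ℤ∞-reflexive refl = ≤ℤ∞-refl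

≤ℤ∞-trans : ∀ {x y z} → x ≤ℤ∞ y → y ≤ℤ∞ z → x ≤ℤ∞ z
≤ℤ∞-trans (fin≤ p) (fin≤ q) = fin≤ (ℤP.≤-trans p q)
≤ℤ∞-trans _ ≤∞ = ≤∞

≤ℤ∞-antisym : ∀ {x y} → x ≤ℤ∞ y → y ≤ℤ∞ x → x ≡ y
≤ℤ∞-antisym (fin≤ p) (fin≤ q) = cong [_] (ℤP.≤-antisym p q)
≤ℤ∞-antisym ≤∞ ≤∞ = refl

∞≤⇒≡∞ : ∀ {x} → ∞ ≤ℤ∞ x → x ≡ ∞
∞≤⇒≡∞ ≤∞ = refl

minℤ∞-≤ˡ : ∀ x y → minℤ∞ x y ≤ℤ∞ x
minℤ∞-≤ˡ [ a ] [ b ] = fin≤ (ℤP.i⊓j≤i a b)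
minℤ∞-≤ˡ [ a ] ∞ = ≤ℤ∞-refl
minℤ∞-≤ˡ ∞ y = ≤∞

minℤ∞-≤ʳ : ∀ x y → minℤ∞ x y ≤ℤ∞ y
minℤ∞-≤ʳ [ a ] [ b ] = fin≤ (ℤP.i⊓j≤j a b)
minℤ∞-≤ʳ [ a ] ∞ = ≤∞
minℤ∞-≤ʳ ∞ y = ≤ℤ∞-refl

minℤ∞-glb : ∀ {z} x y → z ≤ℤ∞ x → z ≤ℤ∞ y → z ≤ℤ∞ minℤ∞ x y
minℤ∞-glb [ a ] [ b ] (fin≤ p) (fin≤ q) = fin≤ (ℤP.⊓-glb p q)
minℤ∞-glb [ a ] ∞ p q = p
minℤ∞-glb ∞ y p q = q

minℤ∞-mono : ∀ {x x′ y y′} → x ≤ℤ∞ x′ → y ≤ℤ∞ y′ → minℤ∞ x y ≤ℤ∞ minℤ∞ x′ y′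
minℤ∞-mono {x} {x′} {y} {y′} p q =
  minℤ∞-glb x′ y′ (≤ℤ∞-trans (minℤ∞-≤ˡ x y) p) (≤ℤ∞-trans (minℤ∞-≤ʳ x y) q)

minFin-≤ : ∀ {n} (f : Fin n → ℤ∞) i → minFin f ≤ℤ∞ f i
minFin-≤ f zero = minℤ∞-≤ˡ (f zero) _
minFin-≤ f (suc i) = ≤ℤ∞-trans (minℤ∞-≤ʳ (f zero) _) (minFin-≤ (f ∘ suc) i)

minFin-greatest : ∀ {n z} (f : Fin n → ℤ∞) → (∀ i → z ≤ℤ∞ f i) → z ≤ℤ∞ minFin f
minFin-greatest {ℕ.zero} f z≤f = ≤∞
minFin-greatest {ℕ.suc n} f z≤f = minℤ∞-glb (f zero) _ (z≤f zero) (minFin-greatest (f ∘ suc) (z≤f ∘ suc))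

minFin-cong : ∀ {n} {f g : Fin n → ℤ∞} → (∀ i → f i ≡ g i) → minFin f ≡ minFin g
minFin-cong {ℕ.zero} f≡g = refl
minFin-cong {ℕ.suc n} f≡g = cong₂ minℤ∞ (f≡g zero) (minFin-cong (f≡g ∘ suc))

+ℤ∞-nonNeg-≤ : ∀ x y → [ + 0 ] ≤ℤ∞ x → y ≤ℤ∞ (x +ℤ∞ y)
+ℤ∞-nonNeg-≤ [ a ] [ b ] (fin≤ 0≤a) = fin≤ (ℤP.i≤j+i b a {{ℤ.nonNegative 0≤a}})
+ℤ∞-nonNeg-≤ [ a ] ∞ _ = ≤∞
+ℤ∞-nonNeg-≤ ∞ y _ = ≤∞

0≤_<1 : ℚ∞ → Set
0≤ y <1 = ([ ℚ.0ℚ ] ≤ℚ∞ y) × (y <ℚ∞ [ ℚ.1ℚ ])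

⌊a⊕y⌋∞≡a : ∀ a y → 0≤ y <1 → ⌊ a ⊕ y ⌋∞ ≡ a
⌊a⊕y⌋∞≡a [ z ] [ q ] (fin≤ 0≤q , fin< q<1) = cong [_] (begin
  floor (z ℚ./ 1 ℚ.+ q) ≡⟨ floor-+ z q ⟩
  z ℤ.+ floor q         ≡⟨ cong (λ f → z ℤ.+ f) (floor-unique (+ 0) q 0≤q q<1) ⟩
  z ℤ.+ + 0             ≡⟨ ℤP.+-identityʳ z ⟩
  z                     ∎)
  where open ≡-Reasoning
⌊a⊕y⌋∞≡a ∞ [ q ] _ = refl

⌊y⌋∞≡0⇒0≤y<1 : ∀ y → ⌊ y ⌋∞ ≡ [ + 0 ] → 0≤ y <1
⌊y⌋∞≡0⇒0≤y<1 [ q ] ⌊q⌋≡0 with floor q | []-injective ⌊q⌋≡0 | floor-bounds q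
... | _ | refl | 0≤q , q<1 = fin≤ 0≤q , fin< q<1

module SupportedSum (M : CommutativeMonoid 0ℓ 0ℓ) where
  open CommutativeMonoid M
  open MonoidSum M

  sum-supported : ∀ {n} (f : Fin n → Carrier) k → (∀ j → j ≢ k → f j ≈ ε) → sum f ≈ f k
  sum-supported {ℕ.suc n} f k f≈ε = begin
    sum f                           ≈⟨ sum-remove {i = k} f ⟩
    f k ∙ sum (f ∘ punchIn k)       ≈⟨ ∙-congˡ (sum-cong-≋ (λ j → f≈ε (punchIn k j) (punchInᵢ≢i k j))) ⟩
    f k ∙ sum {n} (λ _ → ε)         ≈⟨ ∙-congˡ (sum-replicate-zero n) ⟩
    f k ∙ ε                         ≈⟨ identityʳ (f k) ⟩
    f k                             ∎
    where open import Relation.Binary.Reasoning.Setoid setoid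

module RingSum (R : CommutativeRing 0ℓ 0ℓ) where
  open CommutativeRing R using (Carrier; _+_; semiring; +-commutativeMonoid)
  open SemiringSum semiring public
  open SupportedSum +-commutativeMonoid public

  Σ≡sum : ∀ {n} (f : Fin n → Carrier) → Σ[ R ] f ≡ sum f
  Σ≡sum {ℕ.zero} f = refl
  Σ≡sum {ℕ.suc n} f = cong (λ s → f zero + s) (Σ≡sum (f ∘ suc))

module MatrixAction (K : CommutativeRing 0ℓ 0ℓ) where
  open CommutativeRing K hiding (zero) renaming (refl to ≈-refl; sym to ≈-sym; trans to ≈-trans)
  open RingSum K

  infixr 7 _·ᵥ_
  _·ᵥ_ : ∀ {n} → Matrix K n → (Fin n → Carrier) → Fin n → Carrier
  (T ·ᵥ x) i = sum (λ j → T i j * x j)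

  I-diag : ∀ {n} (i : Fin n) → I K i i ≈ 1#
  I-diag i with i ≟ᶠ i
  ... | yes _ = ≈-refl
  ... | no i≢i = ⊥-elim (i≢i refl)

  I-off : ∀ {n} {i j : Fin n} → i ≢ j → I K i j ≈ 0#
  I-off {i = i} {j} i≢j with i ≟ᶠ j
  ... | yes i≡j = ⊥-elim (i≢j i≡j)
  ... | no _ = ≈-refl

  I-·ᵥ : ∀ {n} (x : Fin n → Carrier) k → (I K ·ᵥ x) k ≈ x k
  I-·ᵥ x k = ≈-trans (sum-supported (λ j → I K k j * x j) k
                      (λ j j≢k → ≈-trans (*-congʳ (I-off (j≢k ∘ sym))) (zeroˡ (x j))))
                   (≈-trans (*-congʳ (I-diag k)) (*-identityˡ (x k)))

  ·ᵥ-assoc : ∀ {n} (S T : Matrix K n) x k → (S ·ᵥ T ·ᵥ x) k ≈ (_·_ K S T ·ᵥ x) k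
  ·ᵥ-assoc S T x k = begin
    sum (λ i → S k i * sum (λ j → T i j * x j))     ≈⟨ sum-cong-≋ (λ i → *-distribˡ-sum (S k i) (λ j → T i j * x j)) ⟩
    sum (λ i → sum (λ j → S k i * (T i j * x j)))   ≈⟨ ∑-comm (λ i j → S k i * (T i j * x j)) ⟩
    sum (λ j → sum (λ i → S k i * (T i j * x j)))   ≈⟨ sum-cong-≋ (λ j → sum-cong-≋ (λ i → ≈-sym (*-assoc (S k i) (T i j) (x j)))) ⟩
    sum (λ j → sum (λ i → S k i * T i j * x j))     ≈⟨ sum-cong-≋ (λ j → *-distribʳ-sum (x j) (λ i → S k i * T i j)) ⟨
    sum (λ j → sum (λ i → S k i * T i j) * x j)     ≡⟨ sum-cong-≗ (λ j → cong (_* x j) (Σ≡sum (λ i → S k i * T i j))) ⟨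
    (_·_ K S T ·ᵥ x) k                              ∎
    where open import Relation.Binary.Reasoning.Setoid setoid

  ·ᵥ-inverse : ∀ {n} (S T : Matrix K n) → _≈M_ K (_·_ K S T) (I K) → ∀ x k → (S ·ᵥ T ·ᵥ x) k ≈ x k
  ·ᵥ-inverse S T S·T≈I x k =
    ≈-trans (·ᵥ-assoc S T x k) (≈-trans (sum-cong-≋ (λ j → *-congʳ (S·T≈I k j))) (I-·ᵥ x k))

module ValuationLemmas (K : CommutativeRing 0ℓ 0ℓ) (v : CommutativeRing.Carrier K → ℤ∞)
                       (isValuation : IsDiscreteValuation K v) where
  open CommutativeRing K hiding (zero) renaming (refl to ≈-refl; sym to ≈-sym; trans to ≈-trans)
  open IsDiscreteValuation isValuation
  open RingSum K
  open MatrixAction K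

  v-0# : v 0# ≡ ∞
  v-0# = Equivalence.from (v-∞ 0#) ≈-refl

  v-1# : ¬ (1# ≈ 0#) → v 1# ≡ [ + 0 ]
  v-1# 1≉0 with v 1# in v1≡
  ... | ∞ = ⊥-elim (1≉0 (Equivalence.to (v-∞ 1#) v1≡))
  ... | [ a ] = cong [_] (identityʳ-unique a a ([]-injective (sym [a]≡[a+a])))
    where
    open GroupProperties (AbelianGroup.group ℤP.+-0-abelianGroup) using (identityʳ-unique)
    open ≡-Reasoning
    [a]≡[a+a] : [ a ] ≡ [ a ℤ.+ a ]
    [a]≡[a+a] = begin
      [ a ]             ≡⟨ sym v1≡ ⟩
      v 1#              ≡⟨ v-cong (≈-sym (*-identityˡ 1#)) ⟩
      v (1# * 1#)       ≡⟨ v-mul 1# 1# ⟩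
      v 1# +ℤ∞ v 1#     ≡⟨ cong₂ _+ℤ∞_ v1≡ v1≡ ⟩
      [ a ℤ.+ a ]       ∎

  v-sum : ∀ {n} (f : Fin n → Carrier) → minFin (λ i → v (f i)) ≤ℤ∞ v (sum f)
  v-sum {ℕ.zero} f = ≤ℤ∞-reflexive (sym v-0#)
  v-sum {ℕ.suc n} f =
    ≤ℤ∞-trans (minℤ∞-mono ≤ℤ∞-refl (v-sum (f ∘ suc))) (v-add (f zero) (sum (f ∘ suc)))

  v-*-integral : ∀ a x → InAp K v a → v x ≤ℤ∞ v (a * x)
  v-*-integral a x 0≤va = subst (v x ≤ℤ∞_) (sym (v-mul a x)) (+ℤ∞-nonNeg-≤ (v a) (v x) 0≤va)

  minFin-v-·ᵥ : ∀ {n} (T : Matrix K n) → (∀ i j → InAp K v (T i j)) → ∀ x →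
                minFin (λ i → v (x i)) ≤ℤ∞ minFin (λ i → v ((T ·ᵥ x) i))
  minFin-v-·ᵥ T T-integral x = minFin-greatest _ (λ i → ≤ℤ∞-trans
    (minFin-greatest _ (λ j → ≤ℤ∞-trans (minFin-≤ (λ k → v (x k)) j) (v-*-integral (T i j) (x j) (T-integral i j))))
    (v-sum (λ j → T i j * x j)))

  minFin-v-·ᵥ-GL : ∀ {n} {T : Matrix K n} → InGL K v T → ∀ x →
                   minFin (λ i → v ((T ·ᵥ x) i)) ≡ minFin (λ i → v (x i))
  minFin-v-·ᵥ-GL {T = T} (T-integral , S , S-integral , _ , S·T≈I) x = ≤ℤ∞-antisym
    (≤ℤ∞-trans (minFin-v-·ᵥ S S-integral (T ·ᵥ x))
               (≤ℤ∞-reflexive (minFin-cong (λ k → v-cong (·ᵥ-inverse S T S·T≈I x k)))))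
    (minFin-v-·ᵥ T T-integral x)

  I-integral : ¬ (1# ≈ 0#) → ∀ {n} (i j : Fin n) → InAp K v (I K i j)
  I-integral 1≉0 i j = case i ≟ᶠ j of λ where
    (yes refl) → ≤ℤ∞-reflexive (sym (trans (v-cong (I-diag i)) (v-1# 1≉0)))
    (no i≢j)   → subst ([ + 0 ] ≤ℤ∞_) (sym (trans (v-cong (I-off i≢j)) v-0#)) ≤∞

  minFin-v-I : ¬ (1# ≈ 0#) → ∀ {n} (j : Fin n) → minFin (λ i → v (I K i j)) ≡ [ + 0 ]
  minFin-v-I 1≉0 j = ≤ℤ∞-antisym
    (≤ℤ∞-trans (minFin-≤ _ j) (≤ℤ∞-reflexive (trans (v-cong (I-diag j)) (v-1# 1≉0))))
    (minFin-greatest _ (λ i → I-integral 1≉0 i j))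

module Transform (K L : CommutativeRing 0ℓ 0ℓ)
                 (ι : CommutativeRing.Carrier K → CommutativeRing.Carrier L)
                 (ι-homo : RingMorphisms.IsRingHomomorphism (CommutativeRing.rawRing K) (CommutativeRing.rawRing L) ι)
                 where
  open CommutativeRing L hiding (zero) renaming (refl to ≈-refl; sym to ≈-sym; trans to ≈-trans)
  open RingSum L
  open Extension K L ι
  open MatrixAction K
  open import Relation.Binary.Reasoning.Setoid setoid
  private
    module K = CommutativeRing K
    module ΣK = RingSum K
    module ι = RingMorphisms.IsRingHomomorphism ι-homo

  LinearlyIndependent : ∀ {n} → (Fin n → Carrier) → Set
  LinearlyIndependent b = ∀ x → lincomb x b ≈ 0# → ∀ i → x i K.≈ K.0#

  Spans : ∀ {n} → (Fin n → Carrier) → Set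
  Spans b = ∀ y → ∃ λ x → lincomb x b ≈ y

  ι-sum : ∀ {n} (f : Fin n → K.Carrier) → ι (ΣK.sum f) ≈ sum (ι ∘ f)
  ι-sum {ℕ.zero} f = ι.0#-homo
  ι-sum {ℕ.suc n} f = ≈-trans (ι.+-homo (f zero) (ΣK.sum (f ∘ suc))) (+-congˡ (ι-sum (f ∘ suc)))

  •-assoc-comm : ∀ a t y → a • (t • y) ≈ (t K.* a) • y
  •-assoc-comm a t y = ≈-trans (≈-sym (*-assoc (ι a) (ι t) y))
                               (*-congʳ (≈-trans (*-comm (ι a) (ι t)) (≈-sym (ι.*-homo t a))))

  lincomb-cong : ∀ {n} {x y : Fin n → K.Carrier} (b : Fin n → Carrier) →
                 (∀ i → x i K.≈ y i) → lincomb x b ≈ lincomb y b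
  lincomb-cong {x = x} {y} b x≈y = begin
    lincomb x b               ≡⟨ Σ≡sum (λ i → x i • b i) ⟩
    sum (λ i → x i • b i)     ≈⟨ sum-cong-≋ (λ i → *-congʳ (ι.⟦⟧-cong (x≈y i))) ⟩
    sum (λ i → y i • b i)     ≡⟨ Σ≡sum (λ i → y i • b i) ⟨
    lincomb y b               ∎

  lincomb-transform : ∀ {n} (b' : Fin n → Carrier) (T : Matrix K n) x →
                      lincomb x (transform b' T) ≈ lincomb (T ·ᵥ x) b'
  lincomb-transform b' T x = begin
    lincomb x (transform b' T)                            ≡⟨ Σ≡sum (λ j → x j • transform b' T j) ⟩
    sum (λ j → x j • lincomb (λ i → T i j) b')            ≡⟨ sum-cong-≗ (λ j → cong (ι (x j) *_) (Σ≡sum (λ i → T i j • b' i))) ⟩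
    sum (λ j → x j • sum (λ i → T i j • b' i))            ≈⟨ sum-cong-≋ (λ j → *-distribˡ-sum (ι (x j)) (λ i → T i j • b' i)) ⟩
    sum (λ j → sum (λ i → x j • (T i j • b' i)))          ≈⟨ ∑-comm (λ j i → x j • (T i j • b' i)) ⟩
    sum (λ i → sum (λ j → x j • (T i j • b' i)))          ≈⟨ sum-cong-≋ (λ i → sum-cong-≋ (λ j → •-assoc-comm (x j) (T i j) (b' i))) ⟩
    sum (λ i → sum (λ j → (T i j K.* x j) • b' i))        ≈⟨ sum-cong-≋ (λ i → *-distribʳ-sum (b' i) (λ j → ι (T i j K.* x j))) ⟨
    sum (λ i → sum (λ j → ι (T i j K.* x j)) * b' i)      ≈⟨ sum-cong-≋ (λ i → *-congʳ (ι-sum (λ j → T i j K.* x j))) ⟨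
    sum (λ i → (T ·ᵥ x) i • b' i)                         ≡⟨ Σ≡sum (λ i → (T ·ᵥ x) i • b' i) ⟨
    lincomb (T ·ᵥ x) b'                                   ∎

  lincomb-I : ∀ {n} (b : Fin n → Carrier) j → lincomb (λ i → I K i j) b ≈ b j
  lincomb-I b j = begin
    lincomb (λ i → I K i j) b     ≡⟨ Σ≡sum (λ i → I K i j • b i) ⟩
    sum (λ i → I K i j • b i)     ≈⟨ sum-supported (λ i → I K i j • b i) j off-diagonal ⟩
    I K j j • b j                 ≈⟨ *-congʳ (≈-trans (ι.⟦⟧-cong (I-diag j)) ι.1#-homo) ⟩
    1# * b j                      ≈⟨ *-identityˡ (b j) ⟩
    b j                           ∎
    where
    off-diagonal : ∀ i → i ≢ j → I K i j • b i ≈ 0#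
    off-diagonal i i≢j = ≈-trans (*-congʳ (≈-trans (ι.⟦⟧-cong (I-off i≢j)) ι.0#-homo)) (zeroˡ (b i))

  transform-spans : ∀ {n} {b' : Fin n → Carrier} (T S : Matrix K n) →
                    Spans b' → _≈M_ K (_·_ K T S) (I K) → Spans (transform b' T)
  transform-spans {b' = b'} T S b'-spans T·S≈I y with b'-spans y
  ... | μ , μ-represents-y = S ·ᵥ μ , (begin
    lincomb (S ·ᵥ μ) (transform b' T)   ≈⟨ lincomb-transform b' T (S ·ᵥ μ) ⟩
    lincomb (T ·ᵥ S ·ᵥ μ) b'            ≈⟨ lincomb-cong b' (·ᵥ-inverse T S T·S≈I μ) ⟩
    lincomb μ b'                        ≈⟨ μ-represents-y ⟩
    y                                   ∎)

module SemiOrthonormality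
  (K L : CommutativeRing 0ℓ 0ℓ)
  (ι : CommutativeRing.Carrier K → CommutativeRing.Carrier L)
  (ι-homo : RingMorphisms.IsRingHomomorphism (CommutativeRing.rawRing K) (CommutativeRing.rawRing L) ι)
  (v : CommutativeRing.Carrier K → ℤ∞) (isValuation : IsDiscreteValuation K v)
  (w : CommutativeRing.Carrier L → ℚ∞) (isPNorm : Extension.IsPNorm K L ι v w)
  where
  private
    module K = CommutativeRing K
    module L = CommutativeRing L
  open Extension K L ι
  open IsPNorm isPNorm
  open IsDiscreteValuation isValuation using (v-∞)
  open ValuationLemmas K v isValuation
  open MatrixAction K
  open Transform K L ι ι-homo
  open ≡-Reasoning

  FloorNormIsMinValuation : ∀ {n} → (Fin n → L.Carrier) → Set
  FloorNormIsMinValuation b = ∀ x → ⌊ w (lincomb x b) ⌋∞ ≡ minFin (λ i → v (x i))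

  ⌊w[a•y]⌋∞≡v[a] : ∀ a y → 0≤ w y <1 → ⌊ w (a • y) ⌋∞ ≡ v a
  ⌊w[a•y]⌋∞≡v[a] a y 0≤wy<1 = trans (cong ⌊_⌋∞ (w-scalar a y)) (⌊a⊕y⌋∞≡a (v a) (w y) 0≤wy<1)

  semiOrthonormal⇒floorNorm : ∀ {n} {b : Fin n → L.Carrier} →
                              SemiOrthonormal w b → FloorNormIsMinValuation b
  semiOrthonormal⇒floorNorm {b = b} (⌊w⌋-split , 0≤wb<1) x =
    trans (⌊w⌋-split x) (minFin-cong (λ i → ⌊w[a•y]⌋∞≡v[a] (x i) (b i) (0≤wb<1 i)))

  floorNorm⇒semiOrthonormal : ¬ (K.1# K.≈ K.0#) → ∀ {n} {b : Fin n → L.Carrier} →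
                              FloorNormIsMinValuation b → SemiOrthonormal w b
  floorNorm⇒semiOrthonormal 1≉0 {b = b} floorNorm = ⌊w⌋-split , 0≤wb<1
    where
    0≤wb<1 : ∀ j → 0≤ w (b j) <1
    0≤wb<1 j = ⌊y⌋∞≡0⇒0≤y<1 (w (b j)) (begin
      ⌊ w (b j) ⌋∞                         ≡⟨ cong ⌊_⌋∞ (w-cong (L.sym (lincomb-I b j))) ⟩
      ⌊ w (lincomb (λ i → I K i j) b) ⌋∞   ≡⟨ floorNorm (λ i → I K i j) ⟩
      minFin (λ i → v (I K i j))           ≡⟨ minFin-v-I 1≉0 j ⟩
      [ + 0 ]                              ∎)
    ⌊w⌋-split : ∀ x → ⌊ w (lincomb x b) ⌋∞ ≡ minFin (λ j → ⌊ w (x j • b j) ⌋∞)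
    ⌊w⌋-split x = trans (floorNorm x) (sym (minFin-cong (λ j → ⌊w[a•y]⌋∞≡v[a] (x j) (b j) (0≤wb<1 j))))

  floorNorm⇒independent : ∀ {n} {b : Fin n → L.Carrier} →
                          FloorNormIsMinValuation b → LinearlyIndependent b
  floorNorm⇒independent floorNorm x Σxb≈0 i =
    Equivalence.to (v-∞ (x i)) (∞≤⇒≡∞ (subst (_≤ℤ∞ v (x i)) minFin-v-x≡∞ (minFin-≤ (λ k → v (x k)) i)))
    where
    minFin-v-x≡∞ : minFin (λ k → v (x k)) ≡ ∞
    minFin-v-x≡∞ = trans (sym (floorNorm x)) (cong ⌊_⌋∞ (Equivalence.from (w-∞ _) Σxb≈0))

  transform-floorNorm : ∀ {n} {b' : Fin n → L.Carrier} {T : Matrix K n} →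
                        FloorNormIsMinValuation b' → InGL K v T → FloorNormIsMinValuation (transform b' T)
  transform-floorNorm {b' = b'} {T} floorNorm T∈GL x = begin
    ⌊ w (lincomb x (transform b' T)) ⌋∞   ≡⟨ cong ⌊_⌋∞ (w-cong (lincomb-transform b' T x)) ⟩
    ⌊ w (lincomb (T ·ᵥ x) b') ⌋∞          ≡⟨ floorNorm (T ·ᵥ x) ⟩
    minFin (λ i → v ((T ·ᵥ x) i))         ≡⟨ minFin-v-·ᵥ-GL T∈GL x ⟩
    minFin (λ i → v (x i))                ∎

lemma3p3 : (K L : CommutativeRing 0ℓ 0ℓ) → IsField K → IsField L →
    (ι : CommutativeRing.Carrier K → CommutativeRing.Carrier L) →
    RingMorphisms.IsRingHomomorphism (CommutativeRing.rawRing K) (CommutativeRing.rawRing L) ι →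
    (v : CommutativeRing.Carrier K → ℤ∞) → IsDiscreteValuation K v →
    (w : CommutativeRing.Carrier L → ℚ∞) → Extension.IsPNorm K L ι v w →
    (n : ℕ) (b' : Fin n → CommutativeRing.Carrier L) →
    Extension.IsBasis K L ι b' → Extension.SemiOrthonormal K L ι w b' →
    (T : Matrix K n) → InGL K v T →
    Extension.IsBasis K L ι (Extension.transform K L ι b' T)
      × Extension.SemiOrthonormal K L ι w (Extension.transform K L ι b' T)
lemma3p3 K L K-isField _ ι ι-homo v isValuation w isPNorm n b' (_ , b'-spans) b'-semiOrthonormal
         T T∈GL@(_ , S , _ , T·S≈I , _) =
    (floorNorm⇒independent b-floorNorm , transform-spans T S b'-spans T·S≈I)
  , floorNorm⇒semiOrthonormal (IsField.1≉0 K-isField) b-floorNorm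
  where
  open Transform K L ι ι-homo using (transform-spans)
  open SemiOrthonormality K L ι ι-homo v isValuation w isPNorm
  b-floorNorm : FloorNormIsMinValuation (Extension.transform K L ι b' T)
  b-floorNorm = transform-floorNorm (semiOrthonormal⇒floorNorm b'-semiOrthonormal) T∈GL
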